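{- Let $n>1$ and let $\mathbf M_n$ be the lattice with elements $0,a_1,\dots,a_n,1$ where $0<a_i<1$ for all $i$ and the $a_i$ are pairwise incomparable. Then for all $a,b,c\in M_n$: $a\wedge b\le c$ if and only if $a\le_1 b\to c$.
   Context: In a complemented lattice, for $b\in L$, $b^+:=\{x\in L\mid b\vee x=1,\ b\wedge x=0\}$, and $b\to c:=\{x\vee(b\wedge c)\mid x\in b^+\}$. For $a\in L$ and $B\subseteq L$, $a\le_1 B$ means there exists $y\in B$ with $a\le y$. -}

module Defs where

open import Data.Nat using (ℕ)
open import Data.Fin using (Fin)
open import Data.Fin.Properties using (_≟_)
open import Data.Product using (Σ; _×_; _,_)
open import Relation.Binary.PropositionalEquality using (_≡_)
open import Relation.Nullary using (yes; no)

data M (n : ℕ) : Set where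
  bot : M n
  atom : Fin n → M n
  top : M n

data _≤M_ {n : ℕ} : M n → M n → Set where
  bot≤ : ∀ {x} → bot ≤M x
  ≤top : ∀ {x} → x ≤M top
  atom≤atom : ∀ {i} → atom i ≤M atom i

infix 4 _≤M_

_∧_ : ∀ {n} → M n → M n → M n
bot ∧ y = bot
top ∧ y = y
atom i ∧ bot = bot
atom i ∧ top = atom i
atom i ∧ atom j with i ≟ j
... | yes _ = atom i
... | no _ = bot

_∨_ : ∀ {n} → M n → M n → M n
bot ∨ y = y
top ∨ y = top
atom i ∨ bot = atom i
atom i ∨ top = top
atom i ∨ atom j with i ≟ j
... | yes _ = atom i
... | no _ = top

infixr 7 _∧_
infixr 6 _∨_

_⁺ : ∀ {n} → M n → M n → Set
(b ⁺) x = (b ∨ x ≡ top) × (b ∧ x ≡ bot)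

_⇒_ : ∀ {n} → M n → M n → M n → Set
(b ⇒ c) y = Σ (M _) λ x → (b ⁺) x × (y ≡ x ∨ (b ∧ c))

_≤₁_ : ∀ {n} → M n → (M n → Set) → Set
_≤₁_ {n} a B = Σ (M n) λ y → B y × (a ≤M y)

-- M_n is modular, so for a complement x of b the modular law gives
-- (x ∨ (b ∧ c)) ∧ b = (x ∧ b) ∨ (b ∧ c) = b ∧ c; hence a ≤ x ∨ (b ∧ c) forces
-- a ∧ b ≤ c.  Conversely, when a ∧ b ≤ c a suitable complement of b is found
-- by cases: the atom a_i has the complements a_j (j ≠ i), which exist as n > 1;
-- if a_i ≤ a then a_i ≤ c and a_j ∨ (a_i ∧ c) = 1, otherwise a lies below some a_j.
module Submission where

open import Defs
open import Data.Nat using (ℕ; _<_; s≤s)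
open import Data.Fin using (Fin; zero; punchIn)
open import Data.Fin.Properties using (_≟_; punchInᵢ≢i)
open import Data.Product using (∃; _×_; _,_)
open import Data.Sum using (_⊎_; inj₁; inj₂)
open import Data.Empty using (⊥-elim)
open import Function.Base using (_⟨_⟩_)
open import Function.Bundles using (_⇔_; mk⇔)
open import Relation.Nullary using (yes; no)
open import Relation.Binary.PropositionalEquality

module _ {n : ℕ} where

  ∧-idem-atom : (i : Fin n) → atom i ∧ atom i ≡ atom i
  ∧-idem-atom i with i ≟ i
  ... | yes _ = refl
  ... | no i≢i = ⊥-elim (i≢i refl)

  ∨-idem-atom : (i : Fin n) → atom i ∨ atom i ≡ atom i
  ∨-idem-atom i with i ≟ i
  ... | yes _ = refl
  ... | no i≢i = ⊥-elim (i≢i refl)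

  atom-∧-atom-≢ : {i j : Fin n} → i ≢ j → atom i ∧ atom j ≡ bot
  atom-∧-atom-≢ {i} {j} i≢j with i ≟ j
  ... | yes i≡j = ⊥-elim (i≢j i≡j)
  ... | no _ = refl

  atom-∨-atom-≢ : {i j : Fin n} → i ≢ j → atom i ∨ atom j ≡ top
  atom-∨-atom-≢ {i} {j} i≢j with i ≟ j
  ... | yes i≡j = ⊥-elim (i≢j i≡j)
  ... | no _ = refl

  ∧-comm : (x y : M n) → x ∧ y ≡ y ∧ x
  ∧-comm bot bot = refl
  ∧-comm bot (atom j) = refl
  ∧-comm bot top = refl
  ∧-comm (atom i) bot = refl
  ∧-comm (atom i) top = refl
  ∧-comm (atom i) (atom j) with i ≟ j
  ... | yes refl = sym (∧-idem-atom i)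
  ... | no i≢j = sym (atom-∧-atom-≢ (≢-sym i≢j))
  ∧-comm top bot = refl
  ∧-comm top (atom j) = refl
  ∧-comm top top = refl

  ∧-identityʳ : (x : M n) → x ∧ top ≡ x
  ∧-identityʳ bot = refl
  ∧-identityʳ (atom i) = refl
  ∧-identityʳ top = refl

  ∨-identityʳ : (x : M n) → x ∨ bot ≡ x
  ∨-identityʳ bot = refl
  ∨-identityʳ (atom i) = refl
  ∨-identityʳ top = refl

  ≤-refl : (x : M n) → x ≤M x
  ≤-refl bot = bot≤
  ≤-refl (atom i) = atom≤atom
  ≤-refl top = ≤top

  ≤-trans : {x y z : M n} → x ≤M y → y ≤M z → x ≤M z
  ≤-trans bot≤ _ = bot≤
  ≤-trans _ ≤top = ≤top
  ≤-trans atom≤atom y≤z = y≤z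

  x∧y≤x : (x y : M n) → x ∧ y ≤M x
  x∧y≤x bot y = bot≤
  x∧y≤x top y = ≤top
  x∧y≤x (atom i) bot = bot≤
  x∧y≤x (atom i) top = atom≤atom
  x∧y≤x (atom i) (atom j) with i ≟ j
  ... | yes _ = atom≤atom
  ... | no _ = bot≤

  x∧y≤y : (x y : M n) → x ∧ y ≤M y
  x∧y≤y x y = subst (_≤M y) (∧-comm y x) (x∧y≤x y x)

  x≤x∨y : (x y : M n) → x ≤M x ∨ y
  x≤x∨y bot y = bot≤
  x≤x∨y top y = ≤top
  x≤x∨y (atom i) bot = atom≤atom
  x≤x∨y (atom i) top = ≤top
  x≤x∨y (atom i) (atom j) with i ≟ j
  ... | yes _ = atom≤atom
  ... | no _ = ≤top

  ∧-monoˡ-≤ : {x y : M n} (z : M n) → x ≤M y → x ∧ z ≤M y ∧ z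
  ∧-monoˡ-≤ z bot≤ = bot≤
  ∧-monoˡ-≤ z (≤top {x}) = x∧y≤y x z
  ∧-monoˡ-≤ z (atom≤atom {i}) = ≤-refl (atom i ∧ z)

  ≤⇒∧≡ : {x y : M n} → x ≤M y → x ∧ y ≡ x
  ≤⇒∧≡ bot≤ = refl
  ≤⇒∧≡ {x} ≤top = ∧-identityʳ x
  ≤⇒∧≡ (atom≤atom {i}) = ∧-idem-atom i

  ∨-∧-modular : (x : M n) {z b : M n} → z ≤M b → (x ∨ z) ∧ b ≡ (x ∧ b) ∨ z
  ∨-∧-modular x {b = b} bot≤ =
    cong (_∧ b) (∨-identityʳ x) ⟨ trans ⟩ sym (∨-identityʳ (x ∧ b))
  ∨-∧-modular x {z} ≤top = ∧-identityʳ (x ∨ z) ⟨ trans ⟩ cong (_∨ z) (sym (∧-identityʳ x))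
  ∨-∧-modular bot (atom≤atom {i}) = ∧-idem-atom i
  ∨-∧-modular top (atom≤atom {i}) = sym (∨-idem-atom i)
  ∨-∧-modular (atom j) (atom≤atom {i}) with j ≟ i
  ... | yes refl rewrite ∨-idem-atom i | ∧-idem-atom i = refl
  ... | no _ = refl

  atom-⁺ : {i j : Fin n} → j ≢ i → (atom i ⁺) (atom j)
  atom-⁺ j≢i = atom-∨-atom-≢ (≢-sym j≢i) , atom-∧-atom-≢ (≢-sym j≢i)

  ≤₁⇒-intro : {a : M n} (b c x : M n) → (b ⁺) x → a ≤M x ∨ (b ∧ c) → a ≤₁ (b ⇒ c)
  ≤₁⇒-intro b c x x∈b⁺ a≤y = _ , (x , x∈b⁺ , refl) , a≤y

  ≤x∨[b∧c]⇒a∧b≤c : {a b c x : M n} → (b ⁺) x → a ≤M x ∨ (b ∧ c) → a ∧ b ≤M c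
  ≤x∨[b∧c]⇒a∧b≤c {a} {b} {c} {x} (_ , b∧x≡bot) a≤y =
    ≤-trans (subst (a ∧ b ≤M_) ∧-absorbs-complement (∧-monoˡ-≤ b a≤y)) (x∧y≤y b c)
    where
    ∧-absorbs-complement : (x ∨ (b ∧ c)) ∧ b ≡ b ∧ c
    ∧-absorbs-complement = begin
      (x ∨ (b ∧ c)) ∧ b ≡⟨ ∨-∧-modular x (x∧y≤x b c) ⟩
      (x ∧ b) ∨ (b ∧ c) ≡⟨ cong (_∨ (b ∧ c)) (∧-comm x b ⟨ trans ⟩ b∧x≡bot) ⟩
      b ∧ c             ∎
      where open ≡-Reasoning

  ≤₁⇒⇒∧≤ : (a b c : M n) → a ≤₁ (b ⇒ c) → a ∧ b ≤M c
  ≤₁⇒⇒∧≤ a b c (_ , (x , x∈b⁺ , refl) , a≤y) = ≤x∨[b∧c]⇒a∧b≤c x∈b⁺ a≤y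

∃-≢ : {n : ℕ} → 1 < n → (i : Fin n) → ∃ λ j → j ≢ i
∃-≢ (s≤s (s≤s _)) i = punchIn i zero , punchInᵢ≢i i zero

atom≤⊎≤atom-≢ : {n : ℕ} → 1 < n → (a : M n) (i : Fin n) →
  atom i ≤M a ⊎ ∃ λ j → j ≢ i × a ≤M atom j
atom≤⊎≤atom-≢ 1<n bot i with ∃-≢ 1<n i
... | j , j≢i = inj₂ (j , j≢i , bot≤)
atom≤⊎≤atom-≢ 1<n top i = inj₁ ≤top
atom≤⊎≤atom-≢ 1<n (atom k) i with k ≟ i
... | yes refl = inj₁ atom≤atom
... | no k≢i = inj₂ (k , k≢i , atom≤atom)

∧≤⇒≤₁⇒ : {n : ℕ} → 1 < n → (a b c : M n) → a ∧ b ≤M c → a ≤₁ (b ⇒ c)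
∧≤⇒≤₁⇒ 1<n a bot c _ = ≤₁⇒-intro bot c top (refl , refl) ≤top
∧≤⇒≤₁⇒ 1<n a top c a∧top≤c =
  ≤₁⇒-intro top c bot (refl , refl) (subst (_≤M c) (∧-identityʳ a) a∧top≤c)
∧≤⇒≤₁⇒ 1<n a (atom i) c a∧aᵢ≤c with atom≤⊎≤atom-≢ 1<n a i | ∃-≢ 1<n i
... | inj₂ (j , j≢i , a≤aⱼ) | _ =
  ≤₁⇒-intro (atom i) c (atom j) (atom-⁺ j≢i) (≤-trans a≤aⱼ (x≤x∨y (atom j) (atom i ∧ c)))
... | inj₁ aᵢ≤a | j , j≢i =
  ≤₁⇒-intro (atom i) c (atom j) (atom-⁺ j≢i) (subst (a ≤M_) (sym aⱼ∨[aᵢ∧c]≡top) ≤top)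
  where
  aᵢ≤c : atom i ≤M c
  aᵢ≤c = subst (_≤M c) (∧-comm a (atom i) ⟨ trans ⟩ ≤⇒∧≡ aᵢ≤a) a∧aᵢ≤c
  aⱼ∨[aᵢ∧c]≡top : atom j ∨ (atom i ∧ c) ≡ top
  aⱼ∨[aᵢ∧c]≡top = cong (atom j ∨_) (≤⇒∧≡ aᵢ≤c) ⟨ trans ⟩ atom-∨-atom-≢ j≢i

proposition3p6 : (n : ℕ) → 1 < n → (a b c : M n) →
    ((a ∧ b) ≤M c) ⇔ (a ≤₁ (b ⇒ c))
proposition3p6 n 1<n a b c = mk⇔ (∧≤⇒≤₁⇒ 1<n a b c) (≤₁⇒⇒∧≤ a b c)
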